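{- Let $a\in\mathbb N$ and $k=a(a+1)+1$. Then $\Delta(J_k(a))=a(a+1)$ and the Jaconian set of $J_k(a)$ is $\{v_{a+1}\}$; moreover $J_k(a)$ is the smallest Jaco graph in $\{J_n(a):n\in\mathbb N\}$ with these two properties, i.e. for no $n<k$ does $J_n(a)$ have $\Delta(J_n(a))=a(a+1)$ and Jaconian set $\{v_{a+1}\}$.
   Context: For $a\in\mathbb N$, the infinite Jaco graph $J_\infty(a)$ is the directed graph with vertex set $\{v_i:i\in\mathbb N\}$ in which every arc has the form $(v_i,v_j)$ with $i<j$, and for $i<j$, $(v_i,v_j)$ is an arc iff $(a+1)i-d^-(v_i)\ge j$, where $d^-(v_i)$ is the in-degree of $v_i$ (determined recursively). For $n\in\mathbb N$, the finite Jaco graph $J_n(a)$ is the subgraph of $J_\infty(a)$ induced on $\{v_1,\dots,v_n\}$. Degrees are taken in the underlying undirected graph (in-degree plus out-degree in $J_n(a)$), $\Delta(J_n(a))$ is the maximum degree, and the Jaconian set of $J_n(a)$ is the set of vertices of degree $\Delta(J_n(a))$. -}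

module Defs where

open import Data.Nat using (ℕ; zero; suc; _+_; _*_; _∸_; _≤_; _<_; _≤?_; _<?_; _⊔_)
open import Data.Nat.Properties using (_≟_)
open import Data.List using (List; length; filter; map; upTo; foldr)
open import Data.Product using (_×_)
open import Data.Sum using (_⊎_)
open import Relation.Nullary using (Dec; yes; no)
open import Relation.Nullary.Decidable using (_×-dec_; _⊎-dec_)

-- Vertices v_i are indexed by positive naturals i = 1, 2, 3, ...
-- The list [1, ..., m].
range1 : ℕ → List ℕ
range1 m = map suc (upTo m)

-- Given an in-degree function d (correct on indices < j), the number of
-- i with 1 ≤ i < j such that (a+1) i - d(i) ≥ j; this is d⁻(v_j) in J_∞(a).
countIn : ℕ → (ℕ → ℕ) → ℕ → ℕ
countIn a d j = length (filter (λ i → j ≤? (suc a * i ∸ d i)) (range1 (j ∸ 1)))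

-- inDegs a n j = d⁻(v_j) in J_∞(a), correct for every j ≤ n
-- (course-of-values recursion).
inDegs : ℕ → ℕ → ℕ → ℕ
inDegs a zero    j = 0
inDegs a (suc n) j with j ≤? n
... | yes _ = inDegs a n j
... | no  _ = countIn a (inDegs a n) j

inDeg : ℕ → ℕ → ℕ
inDeg a j = inDegs a j j

Arc : ℕ → ℕ → ℕ → Set
Arc a i j = 1 ≤ i × i < j × j ≤ suc a * i ∸ inDeg a i

arc? : ∀ a i j → Dec (Arc a i j)
arc? a i j = (1 ≤? i) ×-dec ((i <? j) ×-dec (j ≤? suc a * i ∸ inDeg a i))

-- Degree of v_i in the underlying undirected graph of J_n(a)
-- (in-degree plus out-degree within {v_1, ..., v_n}).
deg : ℕ → ℕ → ℕ → ℕ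
deg a n i = length (filter (λ j → arc? a i j ⊎-dec arc? a j i) (range1 n))

Δ : ℕ → ℕ → ℕ
Δ a n = foldr _⊔_ 0 (map (deg a n) (range1 n))

IsJaconian : ℕ → ℕ → ℕ → Set
IsJaconian a n i = 1 ≤ i × i ≤ n × deg a n i ≡ Δ a n
  where open import Relation.Binary.PropositionalEquality using (_≡_)

-- For j ≤ a + 1 every earlier vertex is an in-neighbour of v_j, so d⁻(v_j) = j − 1 and v_j
-- reaches exactly up to v_(a j + 1). Hence in J_k(a), k = a(a+1) + 1, the vertex v_(a+1) is adjacent
-- to all other vertices, so it has the largest possible degree k − 1 = a(a+1); a vertex v_i with
-- i ≤ a has degree at most a i, and one with i > a + 1 misses both v_1 and itself. For n < k every
-- degree in J_n(a) is at most n − 1 < a(a+1).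
module Submission where

open import Defs
open import Data.Nat using (ℕ; zero; suc; _+_; _*_; _∸_; _≤_; _<_; _≤?_; _⊔_; z≤n; s≤s; s≤s⁻¹; pred; >-nonZero)
open import Data.Nat.Properties
open import Data.List using (List; []; _∷_; [_]; length; filter; map; upTo; foldr; _++_)
open import Data.List.Properties
  using (filter-all; filter-notAll; filter-accept; filter-reject; filter-++;
         length-++; length-map; length-upTo; map-++; upTo-∷ʳ)
open import Data.List.Membership.Propositional using (_∈_)
open import Data.List.Membership.Propositional.Properties using (∈-map⁺; ∈-map⁻; ∈-upTo⁺; ∈-upTo⁻)
open import Data.List.Relation.Unary.All as All using (All; []; _∷_)
open import Data.List.Relation.Unary.All.Properties as All using ()
open import Data.List.Relation.Unary.Any as Any using (here; there)
open import Data.Product using (_×_; _,_; uncurry)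
open import Data.Sum using (_⊎_; inj₁; inj₂)
open import Data.Empty using (⊥-elim)
open import Function.Bundles using (_⇔_; mk⇔)
open import Relation.Binary.Definitions using (tri<; tri≈; tri>)
open import Relation.Binary.PropositionalEquality using (_≡_; _≢_; refl; sym; trans; cong)
open import Relation.Nullary using (¬_; Dec; yes; no)
open import Relation.Nullary.Decidable using (_⊎-dec_)
open import Relation.Unary using (Decidable)

range1-suc : ∀ n → range1 (suc n) ≡ range1 n ++ [ suc n ]
range1-suc n = trans (cong (map suc) (sym (upTo-∷ʳ n))) (map-++ suc (upTo n) [ n ])

length-range1 : ∀ n → length (range1 n) ≡ n
length-range1 n = trans (length-map suc (upTo n)) (length-upTo n)

∈-range1⁻ : ∀ {x n} → x ∈ range1 n → 1 ≤ x × x ≤ n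
∈-range1⁻ x∈ with ∈-map⁻ suc x∈
... | _ , y∈ , refl = s≤s z≤n , ∈-upTo⁻ y∈

∈-range1⁺ : ∀ {x n} → 1 ≤ x → x ≤ n → x ∈ range1 n
∈-range1⁺ {suc _} _ x≤n = ∈-map⁺ suc (∈-upTo⁺ x≤n)

module _ {P : ℕ → Set} (P? : Decidable P) where

  count : ℕ → ℕ
  count n = length (filter P? (range1 n))

  count-suc : ∀ n → count (suc n) ≡ count n + length (filter P? [ suc n ])
  count-suc n = trans (cong (λ xs → length (filter P? xs)) (range1-suc n))
    (trans (cong length (filter-++ P? (range1 n) [ suc n ])) (length-++ (filter P? (range1 n))))

  count-suc-accept : ∀ {n} → P (suc n) → count (suc n) ≡ suc (count n)
  count-suc-accept {n} p = trans (count-suc n)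
    (trans (cong (λ xs → count n + length xs) (filter-accept P? p)) (+-comm (count n) 1))

  count-suc-reject : ∀ {n} → ¬ P (suc n) → count (suc n) ≡ count n
  count-suc-reject {n} ¬p = trans (count-suc n)
    (trans (cong (λ xs → count n + length xs) (filter-reject P? ¬p)) (+-identityʳ (count n)))

  count-suc-≤ : ∀ n → count (suc n) ≤ suc (count n)
  count-suc-≤ n with P? (suc n)
  ... | yes p = ≤-reflexive (count-suc-accept p)
  ... | no ¬p = ≤-trans (≤-reflexive (count-suc-reject ¬p)) (n≤1+n (count n))

  count-all : ∀ {n} → (∀ j → 1 ≤ j → j ≤ n → P j) → count n ≡ n
  count-all {n} all =
    trans (cong length (filter-all P? (All.tabulate λ j∈ → uncurry (all _) (∈-range1⁻ j∈))))
          (length-range1 n)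

  count<-missing : ∀ {n x} → ¬ P x → 1 ≤ x → x ≤ n → count n < n
  count<-missing {n} ¬px 1≤x x≤n =
    ≤-trans (filter-notAll P? (range1 n) (Any.map (λ { refl → ¬px }) (∈-range1⁺ 1≤x x≤n)))
            (≤-reflexive (length-range1 n))

  count<-missing₂ : ∀ {n x y} → ¬ P x → ¬ P y → 1 ≤ x → x < y → y ≤ n → suc (count n) < n
  count<-missing₂ {zero} _ _ _ () z≤n
  count<-missing₂ {suc m} ¬px ¬py 1≤x x<y y≤1+m with m≤n⇒m<n∨m≡n y≤1+m
  ... | inj₂ refl rewrite count-suc-reject ¬py = s≤s (count<-missing ¬px 1≤x (s≤s⁻¹ x<y))
  ... | inj₁ (s≤s y≤m) = s≤s (≤-trans (s≤s (count-suc-≤ m)) (count<-missing₂ ¬px ¬py 1≤x x<y y≤m))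

  count-all-but : ∀ {n i} → (∀ j → 1 ≤ j → j ≤ n → j ≢ i → P j) → n ≤ suc (count n)
  count-all-but {zero} _ = z≤n
  count-all-but {suc m} all with P? (suc m)
  ... | yes p rewrite count-suc-accept p = s≤s (count-all-but λ j 1≤j j≤m → all j 1≤j (m≤n⇒m≤1+n j≤m))
  ... | no ¬p = ≤-reflexive (cong suc (sym (trans (count-suc-reject ¬p) (count-all all-below))))
    where
    all-below : ∀ j → 1 ≤ j → j ≤ m → P j
    all-below j 1≤j j≤m = all j 1≤j (m≤n⇒m≤1+n j≤m) λ { refl →
      ¬p (all (suc m) (s≤s z≤n) ≤-refl (λ 1+m≡j → <⇒≢ (s≤s j≤m) (sym 1+m≡j))) }

  count-vanishing-beyond : ∀ {b n} → b ≤ n → (∀ j → b < j → ¬ P j) → count n ≡ count b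
  count-vanishing-beyond {n = zero} z≤n _ = refl
  count-vanishing-beyond {n = suc m} b≤1+m none with m≤n⇒m<n∨m≡n b≤1+m
  ... | inj₂ refl = refl
  ... | inj₁ (s≤s b≤m) = trans (count-suc-reject (none (suc m) (s≤s b≤m))) (count-vanishing-beyond b≤m none)

inDegs-suc : ∀ a {m j} → j ≤ m → inDegs a (suc m) j ≡ inDegs a m j
inDegs-suc a {m} {j} j≤m with j ≤? m
... | yes _ = refl
... | no j≰m = ⊥-elim (j≰m j≤m)

inDeg-suc : ∀ a m → inDeg a (suc m) ≡ countIn a (inDegs a m) (suc m)
inDeg-suc a m with suc m ≤? m
... | yes 1+m≤m = ⊥-elim (<-irrefl refl 1+m≤m)
... | no _ = refl

inDegs-stable : ∀ a {n j} → j ≤ n → inDegs a n j ≡ inDeg a j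
inDegs-stable a {zero} z≤n = refl
inDegs-stable a {suc m} j≤1+m with m≤n⇒m<n∨m≡n j≤1+m
... | inj₂ refl = refl
... | inj₁ (s≤s j≤m) = trans (inDegs-suc a j≤m) (inDegs-stable a j≤m)

[1+a]*[1+t]∸t≡1+a*[1+t] : ∀ a t → suc a * suc t ∸ t ≡ suc (a * suc t)
[1+a]*[1+t]∸t≡1+a*[1+t] a t =
  trans (cong (_∸ t) (sym (+-suc t (a * suc t)))) (m+n∸m≡n t (suc (a * suc t)))

-- Strong induction on j: each of v_1, …, v_(j−1) then reaches at least v_(a+1), hence v_j.
inDeg-initial : ∀ a {j} → j ≤ suc a → inDeg a j ≡ j ∸ 1
inDeg-initial a {j} = below j ≤-refl
  where
  below : ∀ {j} n → j ≤ n → j ≤ suc a → inDeg a j ≡ j ∸ 1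
  below zero z≤n _ = refl
  below (suc n) j≤1+n j≤1+a with m≤n⇒m<n∨m≡n j≤1+n
  ... | inj₁ (s≤s j≤n) = below n j≤n j≤1+a
  ... | inj₂ refl = trans (inDeg-suc a n) (count-all _ reaches)
    where
    reaches : ∀ i → 1 ≤ i → i ≤ n → suc n ≤ suc a * i ∸ inDegs a n i
    reaches (suc t) _ i≤n
      rewrite inDegs-stable a i≤n
            | below n i≤n (≤-trans i≤n (≤-trans (n≤1+n n) j≤1+a))
            | [1+a]*[1+t]∸t≡1+a*[1+t] a t
      = s≤s (≤-trans (s≤s⁻¹ j≤1+a) (m≤m*n a (suc t)))

-- The out-neighbours of v_i in J_∞(a) are v_(i+1), …, v_(reach a i).
reach : ℕ → ℕ → ℕ
reach a i = suc a * i ∸ inDeg a i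

reach-initial : ∀ a {t} → t ≤ a → reach a (suc t) ≡ suc (a * suc t)
reach-initial a {t} t≤a rewrite inDeg-initial a (s≤s t≤a) = [1+a]*[1+t]∸t≡1+a*[1+t] a t

reach[1]≤1+a : ∀ a → reach a 1 ≤ suc a
reach[1]≤1+a a = ≤-trans (m∸n≤m (suc a * 1) (inDeg a 1)) (≤-reflexive (*-identityʳ (suc a)))

Adj : ℕ → ℕ → ℕ → Set
Adj a i j = Arc a i j ⊎ Arc a j i

adj? : ∀ a i j → Dec (Adj a i j)
adj? a i j = arc? a i j ⊎-dec arc? a j i

Adj-irrefl : ∀ a i → ¬ Adj a i i
Adj-irrefl a i (inj₁ (_ , i<i , _)) = <-irrefl refl i<i
Adj-irrefl a i (inj₂ (_ , i<i , _)) = <-irrefl refl i<i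

deg<n : ∀ a {n i} → 1 ≤ i → i ≤ n → deg a n i < n
deg<n a {i = i} = count<-missing (adj? a i) (Adj-irrefl a i)

deg[1+a]≡pred : ∀ a {n} → suc a ≤ n → n ≤ reach a (suc a) → deg a n (suc a) ≡ pred n
deg[1+a]≡pred a {n} 1+a≤n n≤reach =
  ≤-antisym (<⇒≤pred (deg<n a (s≤s z≤n) 1+a≤n)) (pred-mono-≤ (count-all-but (adj? a (suc a)) adjacent))
  where
  adjacent : ∀ j → 1 ≤ j → j ≤ n → j ≢ suc a → Adj a (suc a) j
  adjacent j 1≤j j≤n j≢1+a with <-cmp j (suc a)
  ... | tri≈ _ j≡1+a _ = ⊥-elim (j≢1+a j≡1+a)
  ... | tri> _ _ 1+a<j = inj₁ (s≤s z≤n , 1+a<j , ≤-trans j≤n n≤reach)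
  adjacent (suc t) 1≤j _ _ | tri< j<1+a _ _ rewrite reach-initial a (s≤s⁻¹ (<⇒≤ j<1+a)) =
    inj₂ (1≤j , j<1+a , s≤s (m≤m*n a (suc t)))

deg[1+t]≤a*[1+t] : ∀ a {n t} → t ≤ a → suc (a * suc t) ≤ n → deg a n (suc t) ≤ a * suc t
deg[1+t]≤a*[1+t] a {n} {t} t≤a reach≤n =
  ≤-trans (≤-reflexive (count-vanishing-beyond (adj? a (suc t)) reach≤n beyond))
          (s≤s⁻¹ (count<-missing (adj? a (suc t)) (Adj-irrefl a (suc t)) (s≤s z≤n) 1+t≤1+a*[1+t]))
  where
  1+t≤1+a*[1+t] : suc t ≤ suc (a * suc t)
  1+t≤1+a*[1+t] = s≤s (≤-trans t≤a (m≤m*n a (suc t)))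
  beyond : ∀ j → suc (a * suc t) < j → ¬ Adj a (suc t) j
  beyond j reach<j (inj₁ (_ , _ , j≤reach)) =
    <⇒≱ reach<j (≤-trans j≤reach (≤-reflexive (reach-initial a t≤a)))
  beyond j reach<j (inj₂ (_ , j<1+t , _)) = <⇒≱ reach<j (≤-trans (<⇒≤ j<1+t) 1+t≤1+a*[1+t])

1+deg<n : ∀ a {n i} → suc a < i → i ≤ n → suc (deg a n i) < n
1+deg<n a {i = i} 1+a<i = count<-missing₂ (adj? a i) not-adjacent-to-v₁ (Adj-irrefl a i) ≤-refl 1<i
  where
  1<i : 1 < i
  1<i = ≤-trans (s≤s (s≤s z≤n)) 1+a<i
  not-adjacent-to-v₁ : ¬ Adj a i 1
  not-adjacent-to-v₁ (inj₁ (_ , i<1 , _)) = <⇒≱ 1<i (<⇒≤ i<1)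
  not-adjacent-to-v₁ (inj₂ (_ , _ , i≤reach)) = <⇒≱ 1+a<i (≤-trans i≤reach (reach[1]≤1+a a))

foldr-⊔-lub : ∀ {b} {xs : List ℕ} → All (_≤ b) xs → foldr _⊔_ 0 xs ≤ b
foldr-⊔-lub [] = z≤n
foldr-⊔-lub (x≤b ∷ xs≤b) = ⊔-lub x≤b (foldr-⊔-lub xs≤b)

∈⇒≤foldr-⊔ : ∀ {x} {xs : List ℕ} → x ∈ xs → x ≤ foldr _⊔_ 0 xs
∈⇒≤foldr-⊔ {xs = y ∷ _} (here refl) = m≤m⊔n y _
∈⇒≤foldr-⊔ {xs = y ∷ _} (there x∈) = m≤n⇒m≤o⊔n y (∈⇒≤foldr-⊔ x∈)

Δ<n : ∀ a {n} → 1 ≤ n → Δ a n < n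
Δ<n a {suc m} _ =
  s≤s (foldr-⊔-lub (All.map⁺ (All.tabulate λ i∈ → s≤s⁻¹ (uncurry (deg<n a) (∈-range1⁻ i∈)))))

deg≤Δ : ∀ a {n i} → 1 ≤ i → i ≤ n → deg a n i ≤ Δ a n
deg≤Δ a {n} 1≤i i≤n = ∈⇒≤foldr-⊔ (∈-map⁺ (deg a n) (∈-range1⁺ 1≤i i≤n))

1+a≤1+a*[1+a] : ∀ a → suc a ≤ suc (a * suc a)
1+a≤1+a*[1+a] a = s≤s (m≤m*n a (suc a))

deg[1+a]≡a*[1+a] : ∀ a → deg a (suc (a * suc a)) (suc a) ≡ a * suc a
deg[1+a]≡a*[1+a] a = deg[1+a]≡pred a (1+a≤1+a*[1+a] a) (≤-reflexive (sym (reach-initial a ≤-refl)))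

Δ≡a*[1+a] : ∀ a → Δ a (suc (a * suc a)) ≡ a * suc a
Δ≡a*[1+a] a = ≤-antisym (s≤s⁻¹ (Δ<n a (s≤s z≤n)))
  (≤-trans (≤-reflexive (sym (deg[1+a]≡a*[1+a] a))) (deg≤Δ a (s≤s z≤n) (1+a≤1+a*[1+a] a)))

deg<a*[1+a] : ∀ a {i} → 1 ≤ i → i ≤ suc (a * suc a) → i ≢ suc a →
              deg a (suc (a * suc a)) i < a * suc a
deg<a*[1+a] a {i} 1≤i i≤k i≢1+a with <-cmp i (suc a)
... | tri≈ _ i≡1+a _ = ⊥-elim (i≢1+a i≡1+a)
... | tri> _ _ 1+a<i = s≤s⁻¹ (1+deg<n a 1+a<i i≤k)
deg<a*[1+a] a {suc t} _ _ _ | tri< (s≤s t<a) _ _ =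
  ≤-<-trans (deg[1+t]≤a*[1+t] a (<⇒≤ t<a) (s≤s (*-monoʳ-≤ a (s≤s (<⇒≤ t<a)))))
            (*-monoʳ-< a {{>-nonZero (≤-trans (s≤s z≤n) t<a)}} (s≤s t<a))

IsJaconian⇔≡1+a : ∀ a i → IsJaconian a (suc (a * suc a)) i ⇔ i ≡ suc a
IsJaconian⇔≡1+a a i = mk⇔ to from
  where
  to : IsJaconian a (suc (a * suc a)) i → i ≡ suc a
  to (1≤i , i≤k , deg≡Δ) with i ≟ suc a
  ... | yes i≡1+a = i≡1+a
  ... | no i≢1+a = ⊥-elim (<-irrefl (trans deg≡Δ (Δ≡a*[1+a] a)) (deg<a*[1+a] a 1≤i i≤k i≢1+a))
  from : i ≡ suc a → IsJaconian a (suc (a * suc a)) i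
  from refl = s≤s z≤n , 1+a≤1+a*[1+a] a , trans (deg[1+a]≡a*[1+a] a) (sym (Δ≡a*[1+a] a))

theorem2p4 : (a : ℕ) → 1 ≤ a →
    (Δ a (a * (a + 1) + 1) ≡ a * (a + 1)
      × (∀ i → IsJaconian a (a * (a + 1) + 1) i ⇔ i ≡ a + 1))
    × (∀ n → 1 ≤ n → n < a * (a + 1) + 1 →
        ¬ (Δ a n ≡ a * (a + 1) × (∀ i → IsJaconian a n i ⇔ i ≡ a + 1)))
theorem2p4 a _ rewrite +-comm a 1 | +-comm (a * suc a) 1 =
  (Δ≡a*[1+a] a , IsJaconian⇔≡1+a a) ,
  λ n 1≤n n<k (Δ≡ , _) → <-irrefl Δ≡ (<-≤-trans (Δ<n a 1≤n) (s≤s⁻¹ n<k))
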